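{- For any colored tree poset $P$, the game equality $\mathrm{Po}(P)=\mathrm{Po}(\operatorname{ess} P)$ holds, where $\operatorname{ess}P$ is the essential part of $P$ (with the induced order and coloring).
   Context: A tree poset is either empty or a finite poset in which every element except one (the root) covers exactly one element; colored means each element is colored black or white. A blocking triple is a triple $x\lessdot y\lessdot z$ (covering relations) with $x,y$ of the same color and $z$ of a different color. The essential part $\operatorname{ess}P$ of a colored tree poset $P$ is the (unique) maximal upper set of $P$ that does not contain any blocking triple. $\mathrm{Po}(Q)$ denotes the pomax game on a colored poset $Q$: White (Left) and Black (Right) alternately remove a maximal element of the remaining subposet of their own color; a player who cannot move loses. Equality of games is Conway's equivalence ($G=H$ iff $G-H$ is a second-player win). -}

module Defs where

open import Data.Nat using (ℕ; zero; suc; _+_)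
open import Data.List using (List; []; _∷_; _++_; map; [_])
open import Data.List.Membership.Propositional using (_∈_)
open import Data.List.Relation.Unary.Any using (Any)
open import Data.Maybe using (Maybe; nothing; just)
open import Data.Product using (_×_; Σ; _,_)
open import Data.Sum using (_⊎_)
open import Data.Empty using (⊥)
open import Data.Unit using (⊤)
open import Relation.Binary.PropositionalEquality using (_≡_; _≢_)
open import Relation.Nullary using (¬_)

-- Short combinatorial games (Conway), normal play.
-- mk L R : L = list of Left options, R = list of Right options.

data Game : Set where
  mk : List Game → List Game → Game

mutual
  neg : Game → Game
  neg (mk L R) = mk (negs R) (negs L)

  negs : List Game → List Game
  negs []       = []
  negs (g ∷ gs) = neg g ∷ negs gs

mutual
  _⊕_ : Game → Game → Game
  G@(mk GL GR) ⊕ H@(mk HL HR) =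
    mk (addˡ GL H ++ addʳ G HL) (addˡ GR H ++ addʳ G HR)

  addˡ : List Game → Game → List Game
  addˡ []       H = []
  addˡ (g ∷ gs) H = (g ⊕ H) ∷ addˡ gs H

  addʳ : Game → List Game → List Game
  addʳ G []       = []
  addʳ G (h ∷ hs) = (G ⊕ h) ∷ addʳ G hs

-- LFirst G  : Left, moving first in G, has a winning strategy
--  LSecond G : Left, moving second in G (Right starts), has a winning strategy
--  RFirst / RSecond : likewise for Right.
mutual
  LFirst : Game → Set
  LFirst (mk L R) = SomeLSecond L

  LSecond : Game → Set
  LSecond (mk L R) = AllLFirst R

  SomeLSecond : List Game → Set
  SomeLSecond []       = ⊥
  SomeLSecond (g ∷ gs) = LSecond g ⊎ SomeLSecond gs

  AllLFirst : List Game → Set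
  AllLFirst []       = ⊤
  AllLFirst (g ∷ gs) = LFirst g × AllLFirst gs

mutual
  RFirst : Game → Set
  RFirst (mk L R) = SomeRSecond R

  RSecond : Game → Set
  RSecond (mk L R) = AllRFirst L

  SomeRSecond : List Game → Set
  SomeRSecond []       = ⊥
  SomeRSecond (g ∷ gs) = RSecond g ⊎ SomeRSecond gs

  AllRFirst : List Game → Set
  AllRFirst []       = ⊤
  AllRFirst (g ∷ gs) = RFirst g × AllRFirst gs

SecondPlayerWin : Game → Set
SecondPlayerWin G = RSecond G × LSecond G

_≈G_ : Game → Game → Set
G ≈G H = SecondPlayerWin (G ⊕ neg H)

-- Colours.  White = Left, Black = Right.

data Color : Set where
  white black : Color

-- The elements are the nodes; x ≤ y iff x is an ancestor of (or equal to) y,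
-- so a root is minimal, covering relations are parent ⋖ child, and the
-- maximal elements are the leaves.

data Tree : Set where
  node : Color → List Tree → Tree

Forest : Set
Forest = List Tree

TreePoset : Set
TreePoset = Maybe Tree

forestOf : TreePoset → Forest
forestOf nothing  = []
forestOf (just t) = t ∷ []

mutual
  sizeT : Tree → ℕ
  sizeT (node c ks) = suc (sizeF ks)

  sizeF : Forest → ℕ
  sizeF []       = zero
  sizeF (t ∷ ts) = sizeT t + sizeF ts

mutual
  remT : Color → Tree → List Forest
  remT white (node white []) = [] ∷ []
  remT black (node black []) = [] ∷ []
  remT white (node black []) = []
  remT black (node white []) = []
  remT c (node d ks@(_ ∷ _)) = map (λ ks′ → node d ks′ ∷ []) (remF c ks)

  remF : Color → Forest → List Forest
  remF c []       = []
  remF c (t ∷ ts) = map (_++ ts) (remT c t) ++ map (t ∷_) (remF c ts)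

-- The pomax game; the fuel n is the number of remaining elements
-- (every move removes exactly one element).
PoN : ℕ → Forest → Game
PoN zero    f = mk [] []
PoN (suc n) f = mk (map (PoN n) (remF white f)) (map (PoN n) (remF black f))

Po : Forest → Game
Po f = PoN (sizeF f) f

-- Blocking triples  x ⋖ y ⋖ z  with col x = col y ≠ col z.

data HasBlockT : Tree → Set where
  here  : ∀ {c ks d ms e ns} → node d ms ∈ ks → node e ns ∈ ms →
          c ≡ d → d ≢ e → HasBlockT (node c ks)
  there : ∀ {c ks t} → t ∈ ks → HasBlockT t → HasBlockT (node c ks)

HasBlockF : Forest → Set
HasBlockF f = Any HasBlockT f

-- An upper set of a tree either contains the root (hence, being upward
-- closed, the whole tree: `whole`), or does not contain the root and is
-- given by upper sets of the subtrees of the children (`cut`).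

mutual
  data UpT : Tree → Set where
    whole : ∀ {t} → UpT t
    cut   : ∀ {c ks} → UpF ks → UpT (node c ks)

  data UpF : Forest → Set where
    []  : UpF []
    _∷_ : ∀ {t ts} → UpT t → UpF ts → UpF (t ∷ ts)

mutual
  carT : ∀ {t} → UpT t → Forest
  carT {t} whole = t ∷ []
  carT (cut u)   = carF u

  carF : ∀ {f} → UpF f → Forest
  carF []       = []
  carF (u ∷ us) = carT u ++ carF us

mutual
  _⊆T_ : ∀ {t} → UpT t → UpT t → Set
  u     ⊆T whole = ⊤
  whole ⊆T cut v = ⊥
  cut u ⊆T cut v = u ⊆F v

  _⊆F_ : ∀ {f} → UpF f → UpF f → Set
  []       ⊆F []       = ⊤
  (u ∷ us) ⊆F (v ∷ vs) = u ⊆T v × us ⊆F vs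

IsEss : (P : TreePoset) → UpF (forestOf P) → Set
IsEss P U = ¬ HasBlockF (carF U) ×
            (∀ V → ¬ HasBlockF (carF V) → U ⊆F V → V ⊆F U)

-- Po(F) is the integer v(F) obtained by counting the essential part of F, white elements +1 and
-- black ones −1.  An integer-valued game is certified by: Left options are worth less, Right
-- options more, and the player who is ahead can move one step towards 0; such certificates are
-- closed under negation and sum, and G − n is a second-player win when G is certified as n.
-- For pomax, every White move lowers v, possibly by more than one when it destroys a blocking
-- triple, and if v > 0 White can lower it by exactly one without changing which nodes are
-- blocked; Black is handled by swapping colours.  Since ess P has the same essential part as
-- P, Po(P) and Po(ess P) are the same integer.
module Submission where

open import Defs
open import Data.Bool using (Bool; true; false; _∨_; _∧_; not; if_then_else_)
open import Data.Bool.Properties using (∨-conicalˡ; ∨-conicalʳ; ∨-identityʳ; ∨-assoc; ∧-zeroʳ; ∧-conicalˡ; ∧-conicalʳ)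
open import Data.Empty using (⊥-elim)
open import Data.Integer using (ℤ; 0ℤ; 1ℤ; -1ℤ; -_; _+_; _<_; _≤_; pred; -≤+; +<+) renaming (suc to sucℤ)
open import Data.Integer.Properties
open import Data.Integer.Tactic.RingSolver using (solve-∀)
open import Data.List using ([]; _∷_; _++_; map)
open import Data.List.Membership.Propositional using (_∈_)
open import Data.List.Membership.Propositional.Properties using (∈-map⁺; ∈-map⁻; ∈-++⁺ˡ; ∈-++⁺ʳ; ∈-++⁻)
open import Data.List.Relation.Unary.All using (All; []; _∷_)
open import Data.List.Relation.Unary.Any using (here; there)
open import Data.List.Relation.Unary.Any.Properties using (++⁺ˡ; ++⁺ʳ; ++⁻)
open import Data.Nat using (zero; suc)
import Data.Nat as ℕ
import Data.Nat.Properties as ℕ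
open import Data.Product using (_×_; _,_; Σ; ∃-syntax; proj₁; proj₂)
open import Data.Sum using (_⊎_; inj₁; inj₂; [_,_]′)
open import Data.Unit using (tt)
open import Function using (id; _∘_; _∘′_)
open import Relation.Binary.PropositionalEquality
open import Relation.Nullary using (¬_; yes; no)

+-sucℤ : ∀ a b → a + sucℤ b ≡ sucℤ (a + b)
+-sucℤ a b = begin
  a + (1ℤ + b)  ≡⟨ +-assoc a 1ℤ b ⟨
  (a + 1ℤ) + b  ≡⟨ cong (_+ b) (+-comm a 1ℤ) ⟩
  (1ℤ + a) + b  ≡⟨ +-assoc 1ℤ a b ⟩
  1ℤ + (a + b)  ∎
  where open ≡-Reasoning

suc[i]≡j⇒suc[i+k]≡j+k : ∀ i k {j} → sucℤ i ≡ j → sucℤ (i + k) ≡ j + k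
suc[i]≡j⇒suc[i+k]≡j+k i k eq = trans (sym (+-assoc 1ℤ i k)) (cong (_+ k) eq)

suc[i]≡j⇒suc[k+i]≡k+j : ∀ i k {j} → sucℤ i ≡ j → sucℤ (k + i) ≡ k + j
suc[i]≡j⇒suc[k+i]≡k+j i k eq = trans (sym (+-sucℤ k i)) (cong (k +_) eq)

neg-distrib-suc : ∀ n → - sucℤ n ≡ pred (- n)
neg-distrib-suc = neg-distrib-+ 1ℤ

neg-distrib-pred : ∀ n → - pred n ≡ sucℤ (- n)
neg-distrib-pred = neg-distrib-+ -1ℤ

<-+⇒ : ∀ {n} a b → n < a + b → 0ℤ < a ⊎ n < b
<-+⇒ a b n<a+b with 0ℤ <? a
... | yes 0<a = inj₁ 0<a
... | no 0≮a = inj₂ (<-≤-trans n<a+b (≤-trans (+-monoˡ-≤ b (≮⇒≥ 0≮a)) (≤-reflexive (+-identityˡ b))))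

+<⇒ : ∀ {n} a b → a + b < n → a < 0ℤ ⊎ b < n
+<⇒ a b a+b<n with a <? 0ℤ
... | yes a<0 = inj₁ a<0
... | no a≮0 = inj₂ (≤-<-trans (≤-trans (≤-reflexive (sym (+-identityˡ b))) (+-monoˡ-≤ b (≮⇒≥ a≮0))) a+b<n)

∨-true⁻ : ∀ a {b} → a ∨ b ≡ true → a ≡ true ⊎ b ≡ true
∨-true⁻ true  _ = inj₁ refl
∨-true⁻ false p = inj₂ p

∨-introˡ : ∀ {a} b → a ≡ true → a ∨ b ≡ true
∨-introˡ b refl = refl

∨-introʳ : ∀ a {b} → b ≡ true → a ∨ b ≡ true
∨-introʳ true  _ = refl
∨-introʳ false p = p

∨-mono : ∀ {a a′ b b′} → (a ≡ true → a′ ≡ true) → (b ≡ true → b′ ≡ true) → a ∨ b ≡ true → a′ ∨ b′ ≡ true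
∨-mono {a} f g p = [ ∨-introˡ _ ∘ f , ∨-introʳ _ ∘ g ]′ (∨-true⁻ a p)

∧-monoʳ : ∀ a {b b′} → (b ≡ true → b′ ≡ true) → a ∧ b ≡ true → a ∧ b′ ≡ true
∧-monoʳ true f = f

contraposeᵇ : ∀ {a b} → (a ≡ true → b ≡ true) → b ≡ false → a ≡ false
contraposeᵇ {false} f _ = refl
contraposeᵇ {true}  f p = trans (sym (f refl)) p

∨-elimˡ : ∀ {a b} → a ∨ b ≡ true → a ≡ false → b ≡ true
∨-elimˡ p refl = p

∨-elimʳ : ∀ {a b} → a ∨ b ≡ true → b ≡ false → a ≡ true
∨-elimʳ {true}  _ _    = refl
∨-elimʳ {false} p refl = p

true≢false : true ≢ false
true≢false ()

true-or-false : ∀ b → b ≡ true ⊎ b ≡ false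
true-or-false true  = inj₁ refl
true-or-false false = inj₂ refl

⇔ᵇ⇒≡ : ∀ {a b} → (a ≡ true → b ≡ true) → (b ≡ true → a ≡ true) → a ≡ b
⇔ᵇ⇒≡ {false} {false} _ _ = refl
⇔ᵇ⇒≡ {false} {true}  _ g = g refl
⇔ᵇ⇒≡ {true}  f _ = sym (f refl)

data HasValue : Game → ℤ → Set where
  hasValue : ∀ {L R n} →
    (∀ {g} → g ∈ L → ∃[ m ] m < n × HasValue g m) →
    (∀ {g} → g ∈ R → ∃[ m ] n < m × HasValue g m) →
    (0ℤ < n → ∃[ g ] g ∈ L × HasValue g (pred n)) →
    (n < 0ℤ → ∃[ g ] g ∈ R × HasValue g (sucℤ n)) →
    HasValue (mk L R) n

allLFirst : ∀ {R} → (∀ {g} → g ∈ R → LFirst g) → AllLFirst R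
allLFirst {[]}    f = tt
allLFirst {g ∷ R} f = f (here refl) , allLFirst (f ∘′ there)

allRFirst : ∀ {L} → (∀ {g} → g ∈ L → RFirst g) → AllRFirst L
allRFirst {[]}    f = tt
allRFirst {g ∷ L} f = f (here refl) , allRFirst (f ∘′ there)

someLSecond : ∀ {g L} → g ∈ L → LSecond g → SomeLSecond L
someLSecond (here refl) w = inj₁ w
someLSecond (there g∈L) w = inj₂ (someLSecond g∈L w)

someRSecond : ∀ {g R} → g ∈ R → RSecond g → SomeRSecond R
someRSecond (here refl) w = inj₁ w
someRSecond (there g∈R) w = inj₂ (someRSecond g∈R w)

mutual
  lSecond-nonneg : ∀ {G n} → HasValue G n → 0ℤ ≤ n → LSecond G
  lSecond-nonneg (hasValue _ right _ _) 0≤n = allLFirst λ g∈R →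
    let (m , n<m , g≈m) = right g∈R in lFirst-pos g≈m (≤-<-trans 0≤n n<m)

  lFirst-pos : ∀ {G n} → HasValue G n → 0ℤ < n → LFirst G
  lFirst-pos (hasValue _ _ best _) 0<n =
    let (g , g∈L , g≈n-1) = best 0<n in someLSecond g∈L (lSecond-nonneg g≈n-1 (i<j⇒i≤pred[j] 0<n))

mutual
  rSecond-nonpos : ∀ {G n} → HasValue G n → n ≤ 0ℤ → RSecond G
  rSecond-nonpos (hasValue left _ _ _) n≤0 = allRFirst λ g∈L →
    let (m , m<n , g≈m) = left g∈L in rFirst-neg g≈m (<-≤-trans m<n n≤0)

  rFirst-neg : ∀ {G n} → HasValue G n → n < 0ℤ → RFirst G
  rFirst-neg (hasValue _ _ _ best) n<0 =
    let (g , g∈R , g≈n+1) = best n<0 in someRSecond g∈R (rSecond-nonpos g≈n+1 (i<j⇒suc[i]≤j n<0))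

zero-secondPlayerWin : ∀ {G} → HasValue G 0ℤ → SecondPlayerWin G
zero-secondPlayerWin G≈0 = rSecond-nonpos G≈0 ≤-refl , lSecond-nonneg G≈0 ≤-refl

∈-negs⁺ : ∀ {g gs} → g ∈ gs → neg g ∈ negs gs
∈-negs⁺ (here refl) = here refl
∈-negs⁺ (there g∈gs) = there (∈-negs⁺ g∈gs)

∈-negs⁻ : ∀ {g} gs → g ∈ negs gs → ∃[ h ] h ∈ gs × g ≡ neg h
∈-negs⁻ (h ∷ gs) (here refl) = h , here refl , refl
∈-negs⁻ (h ∷ gs) (there g∈) = let (h′ , h′∈ , eq) = ∈-negs⁻ gs g∈ in h′ , there h′∈ , eq

negValue : ∀ {G n} → HasValue G n → HasValue (neg G) (- n)
negValue {mk L R} {n} (hasValue left right bestL bestR) = hasValue left′ right′ bestL′ bestR′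
  where
  left′ : ∀ {g} → g ∈ negs R → ∃[ m ] m < - n × HasValue g m
  left′ g∈ with ∈-negs⁻ R g∈
  ... | h , h∈R , refl = let (m , n<m , h≈m) = right h∈R in - m , neg-mono-< n<m , negValue h≈m

  right′ : ∀ {g} → g ∈ negs L → ∃[ m ] - n < m × HasValue g m
  right′ g∈ with ∈-negs⁻ L g∈
  ... | h , h∈L , refl = let (m , m<n , h≈m) = left h∈L in - m , neg-mono-< m<n , negValue h≈m

  bestL′ : 0ℤ < - n → ∃[ g ] g ∈ negs R × HasValue g (pred (- n))
  bestL′ 0<-n = let (h , h∈R , h≈n+1) = bestR (neg-cancel-< 0<-n)
                in neg h , ∈-negs⁺ h∈R , subst (HasValue (neg h)) (neg-distrib-suc n) (negValue h≈n+1)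

  bestR′ : - n < 0ℤ → ∃[ g ] g ∈ negs L × HasValue g (sucℤ (- n))
  bestR′ -n<0 = let (h , h∈L , h≈n-1) = bestL (neg-cancel-< -n<0)
                in neg h , ∈-negs⁺ h∈L , subst (HasValue (neg h)) (neg-distrib-pred n) (negValue h≈n-1)

∈-addˡ⁺ : ∀ {g gs H} → g ∈ gs → g ⊕ H ∈ addˡ gs H
∈-addˡ⁺ (here refl) = here refl
∈-addˡ⁺ (there g∈gs) = there (∈-addˡ⁺ g∈gs)

∈-addˡ⁻ : ∀ {x H} gs → x ∈ addˡ gs H → ∃[ g ] g ∈ gs × x ≡ g ⊕ H
∈-addˡ⁻ (g ∷ gs) (here refl) = g , here refl , refl
∈-addˡ⁻ (g ∷ gs) (there x∈) = let (g′ , g′∈ , eq) = ∈-addˡ⁻ gs x∈ in g′ , there g′∈ , eq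

∈-addʳ⁺ : ∀ {G h hs} → h ∈ hs → G ⊕ h ∈ addʳ G hs
∈-addʳ⁺ (here refl) = here refl
∈-addʳ⁺ (there h∈hs) = there (∈-addʳ⁺ h∈hs)

∈-addʳ⁻ : ∀ {x G} hs → x ∈ addʳ G hs → ∃[ h ] h ∈ hs × x ≡ G ⊕ h
∈-addʳ⁻ (h ∷ hs) (here refl) = h , here refl , refl
∈-addʳ⁻ (h ∷ hs) (there x∈) = let (h′ , h′∈ , eq) = ∈-addʳ⁻ hs x∈ in h′ , there h′∈ , eq

∈-⊕-options⁻ : ∀ {x G H} gs hs → x ∈ addˡ gs H ++ addʳ G hs →
               (∃[ g ] g ∈ gs × x ≡ g ⊕ H) ⊎ (∃[ h ] h ∈ hs × x ≡ G ⊕ h)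
∈-⊕-options⁻ {H = H} gs hs x∈ with ∈-++⁻ (addˡ gs H) x∈
... | inj₁ x∈ˡ = inj₁ (∈-addˡ⁻ gs x∈ˡ)
... | inj₂ x∈ʳ = inj₂ (∈-addʳ⁻ hs x∈ʳ)

mutual
  sumValue : ∀ {G H a b} → HasValue G a → HasValue H b → HasValue (G ⊕ H) (a + b)
  sumValue {mk GL GR} {mk HL HR} {a} {b} G≈a H≈b =
    hasValue (sumLeft G≈a H≈b ∘′ ∈-⊕-options⁻ GL HL) (sumRight G≈a H≈b ∘′ ∈-⊕-options⁻ GR HR)
             (sumBestL G≈a H≈b ∘′ <-+⇒ a b) (sumBestR G≈a H≈b ∘′ +<⇒ a b)

  sumLeft : ∀ {GL GR HL HR a b x} → HasValue (mk GL GR) a → HasValue (mk HL HR) b →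
            (∃[ g ] g ∈ GL × x ≡ g ⊕ mk HL HR) ⊎ (∃[ h ] h ∈ HL × x ≡ mk GL GR ⊕ h) →
            ∃[ m ] m < a + b × HasValue x m
  sumLeft {b = b} (hasValue left _ _ _) H≈b (inj₁ (g , g∈ , refl)) =
    let (m , m<a , g≈m) = left g∈ in m + b , +-monoˡ-< b m<a , sumValue g≈m H≈b
  sumLeft {a = a} G≈a (hasValue left _ _ _) (inj₂ (h , h∈ , refl)) =
    let (m , m<b , h≈m) = left h∈ in a + m , +-monoʳ-< a m<b , sumValue G≈a h≈m

  sumRight : ∀ {GL GR HL HR a b x} → HasValue (mk GL GR) a → HasValue (mk HL HR) b →
             (∃[ g ] g ∈ GR × x ≡ g ⊕ mk HL HR) ⊎ (∃[ h ] h ∈ HR × x ≡ mk GL GR ⊕ h) →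
             ∃[ m ] a + b < m × HasValue x m
  sumRight {b = b} (hasValue _ right _ _) H≈b (inj₁ (g , g∈ , refl)) =
    let (m , a<m , g≈m) = right g∈ in m + b , +-monoˡ-< b a<m , sumValue g≈m H≈b
  sumRight {a = a} G≈a (hasValue _ right _ _) (inj₂ (h , h∈ , refl)) =
    let (m , b<m , h≈m) = right h∈ in a + m , +-monoʳ-< a b<m , sumValue G≈a h≈m

  sumBestL : ∀ {GL GR HL HR a b} → HasValue (mk GL GR) a → HasValue (mk HL HR) b → 0ℤ < a ⊎ 0ℤ < b →
             ∃[ x ] x ∈ addˡ GL (mk HL HR) ++ addʳ (mk GL GR) HL × HasValue x (pred (a + b))
  sumBestL {HL = HL} {HR} {a} {b} (hasValue _ _ best _) H≈b (inj₁ 0<a) =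
    let (g , g∈ , g≈a-1) = best 0<a in
    g ⊕ mk HL HR , ∈-++⁺ˡ (∈-addˡ⁺ g∈) , subst (HasValue _) (pred-+ a b) (sumValue g≈a-1 H≈b)
  sumBestL {GL} {GR} {HL} {HR} {a} {b} G≈a (hasValue _ _ best _) (inj₂ 0<b) =
    let (h , h∈ , h≈b-1) = best 0<b in
    mk GL GR ⊕ h , ∈-++⁺ʳ (addˡ GL (mk HL HR)) (∈-addʳ⁺ h∈) ,
    subst (HasValue _) (+-pred a b) (sumValue G≈a h≈b-1)

  sumBestR : ∀ {GL GR HL HR a b} → HasValue (mk GL GR) a → HasValue (mk HL HR) b → a < 0ℤ ⊎ b < 0ℤ →
             ∃[ x ] x ∈ addˡ GR (mk HL HR) ++ addʳ (mk GL GR) HR × HasValue x (sucℤ (a + b))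
  sumBestR {HL = HL} {HR} {a} {b} (hasValue _ _ _ best) H≈b (inj₁ a<0) =
    let (g , g∈ , g≈a+1) = best a<0 in
    g ⊕ mk HL HR , ∈-++⁺ˡ (∈-addˡ⁺ g∈) , subst (HasValue _) (+-assoc 1ℤ a b) (sumValue g≈a+1 H≈b)
  sumBestR {GL} {GR} {HL} {HR} {a} {b} G≈a (hasValue _ _ _ best) (inj₂ b<0) =
    let (h , h∈ , h≈b+1) = best b<0 in
    mk GL GR ⊕ h , ∈-++⁺ʳ (addˡ GR (mk HL HR)) (∈-addʳ⁺ h∈) ,
    subst (HasValue _) (+-sucℤ a b) (sumValue G≈a h≈b+1)

mutual
  data TreeMove (m : Color) : Tree → Forest → Set where
    removeLeaf : TreeMove m (node m []) []
    inside     : ∀ {d ks ks′} → ForestMove m ks ks′ → TreeMove m (node d ks) (node d ks′ ∷ [])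

  data ForestMove (m : Color) : Forest → Forest → Set where
    inFirst : ∀ {t ts r} → TreeMove m t r → ForestMove m (t ∷ ts) (r ++ ts)
    inRest  : ∀ {t ts ts′} → ForestMove m ts ts′ → ForestMove m (t ∷ ts) (t ∷ ts′)

-- remT inspects both colours before it reaches its inner-node clause.
remT-node : ∀ m d k ks → remT m (node d (k ∷ ks)) ≡ map (λ ks′ → node d ks′ ∷ []) (remF m (k ∷ ks))
remT-node white white k ks = refl
remT-node white black k ks = refl
remT-node black white k ks = refl
remT-node black black k ks = refl

mutual
  ∈-remT⁻ : ∀ m t {r} → r ∈ remT m t → TreeMove m t r
  ∈-remT⁻ white (node white []) (here refl) = removeLeaf
  ∈-remT⁻ black (node black []) (here refl) = removeLeaf
  ∈-remT⁻ m (node d (k ∷ ks)) r∈ =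
    let (ks′ , ks′∈ , r≡) = ∈-map⁻ _ (subst (_ ∈_) (remT-node m d k ks) r∈)
    in subst (TreeMove m _) (sym r≡) (inside (∈-remF⁻ m (k ∷ ks) ks′∈))

  ∈-remF⁻ : ∀ m f {f′} → f′ ∈ remF m f → ForestMove m f f′
  ∈-remF⁻ m (t ∷ ts) f′∈ = [ fromFirst , fromRest ]′ (∈-++⁻ (map (_++ ts) (remT m t)) f′∈)
    where
    fromFirst : ∀ {f′} → f′ ∈ map (_++ ts) (remT m t) → ForestMove m (t ∷ ts) f′
    fromFirst f′∈ = let (r , r∈ , f′≡) = ∈-map⁻ (_++ ts) f′∈
                    in subst (ForestMove m _) (sym f′≡) (inFirst (∈-remT⁻ m t r∈))
    fromRest : ∀ {f′} → f′ ∈ map (t ∷_) (remF m ts) → ForestMove m (t ∷ ts) f′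
    fromRest f′∈ = let (ts′ , ts′∈ , f′≡) = ∈-map⁻ (t ∷_) f′∈
                   in subst (ForestMove m _) (sym f′≡) (inRest (∈-remF⁻ m ts ts′∈))

mutual
  ∈-remT⁺ : ∀ {m t r} → TreeMove m t r → r ∈ remT m t
  ∈-remT⁺ {white} removeLeaf = here refl
  ∈-remT⁺ {black} removeLeaf = here refl
  ∈-remT⁺ {m} (inside {d} {k ∷ ks} mv) = subst (_ ∈_) (sym (remT-node m d k ks)) (∈-map⁺ _ (∈-remF⁺ mv))

  ∈-remF⁺ : ∀ {m f f′} → ForestMove m f f′ → f′ ∈ remF m f
  ∈-remF⁺ {m} {t ∷ ts} (inFirst mv) = ∈-++⁺ˡ (∈-map⁺ (_++ ts) (∈-remT⁺ mv))
  ∈-remF⁺ {m} {t ∷ ts} (inRest mv) = ∈-++⁺ʳ (map (_++ ts) (remT m t)) (∈-map⁺ (t ∷_) (∈-remF⁺ mv))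

sizeF-++ : ∀ f g → sizeF (f ++ g) ≡ sizeF f ℕ.+ sizeF g
sizeF-++ []      g = refl
sizeF-++ (t ∷ f) g = trans (cong (sizeT t ℕ.+_) (sizeF-++ f g)) (sym (ℕ.+-assoc (sizeT t) (sizeF f) (sizeF g)))

mutual
  treeMove-size : ∀ {m t r} → TreeMove m t r → sizeT t ≡ suc (sizeF r)
  treeMove-size removeLeaf = refl
  treeMove-size (inside {ks′ = ks′} mv) =
    cong suc (trans (forestMove-size mv) (cong suc (sym (ℕ.+-identityʳ (sizeF ks′)))))

  forestMove-size : ∀ {m f f′} → ForestMove m f f′ → sizeF f ≡ suc (sizeF f′)
  forestMove-size (inFirst {ts = ts} {r} mv) =
    trans (cong (ℕ._+ sizeF ts) (treeMove-size mv)) (cong suc (sym (sizeF-++ r ts)))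
  forestMove-size (inRest {t} {ts′ = ts′} mv) =
    trans (cong (sizeT t ℕ.+_) (forestMove-size mv)) (ℕ.+-suc (sizeT t) (sizeF ts′))

invert : Color → Color
invert white = black
invert black = white

mutual
  invertT : Tree → Tree
  invertT (node c ks) = node (invert c) (invertF ks)

  invertF : Forest → Forest
  invertF []       = []
  invertF (t ∷ ts) = invertT t ∷ invertF ts

mutual
  invertT-involutive : ∀ t → invertT (invertT t) ≡ t
  invertT-involutive (node white ks) = cong (node white) (invertF-involutive ks)
  invertT-involutive (node black ks) = cong (node black) (invertF-involutive ks)

  invertF-involutive : ∀ f → invertF (invertF f) ≡ f
  invertF-involutive []       = refl
  invertF-involutive (t ∷ ts) = cong₂ _∷_ (invertT-involutive t) (invertF-involutive ts)

invertF-++ : ∀ f g → invertF (f ++ g) ≡ invertF f ++ invertF g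
invertF-++ []      g = refl
invertF-++ (t ∷ f) g = cong (invertT t ∷_) (invertF-++ f g)

mutual
  invert-treeMove : ∀ {m t r} → TreeMove m t r → TreeMove (invert m) (invertT t) (invertF r)
  invert-treeMove {white} removeLeaf = removeLeaf
  invert-treeMove {black} removeLeaf = removeLeaf
  invert-treeMove (inside mv) = inside (invert-forestMove mv)

  invert-forestMove : ∀ {m f f′} → ForestMove m f f′ → ForestMove (invert m) (invertF f) (invertF f′)
  invert-forestMove (inFirst {t} {ts} {r} mv) =
    subst (ForestMove _ (invertF (t ∷ ts))) (sym (invertF-++ r ts)) (inFirst (invert-treeMove mv))
  invert-forestMove (inRest mv) = inRest (invert-forestMove mv)

_==ᶜ_ : Color → Color → Bool
white ==ᶜ white = true
black ==ᶜ black = true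
white ==ᶜ black = false
black ==ᶜ white = false

mixed : Color → Forest → Bool
mixed d []              = false
mixed d (node e _ ∷ ts) = not (d ==ᶜ e) ∨ mixed d ts

-- blocked c ks: the tree node c ks contains a blocking triple.  blocks c t: t yields one to a
-- parent of colour c, either inside t or as the middle element of a triple through the parent.
mutual
  blocked : Color → Forest → Bool
  blocked c []       = false
  blocked c (t ∷ ts) = blocks c t ∨ blocked c ts

  blocks : Color → Tree → Bool
  blocks c (node d ms) = blocked d ms ∨ ((c ==ᶜ d) ∧ mixed d ms)

sign : Color → ℤ
sign white = 1ℤ
sign black = -1ℤ

-- An element counts iff its up-set has no blocking triple, i.e. iff it lies in the essential part.
mutual
  valueT : Tree → ℤ
  valueT (node c ks) = valueF ks + (if blocked c ks then 0ℤ else sign c)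

  valueF : Forest → ℤ
  valueF []       = 0ℤ
  valueF (t ∷ ts) = valueT t + valueF ts

==ᶜ-refl : ∀ c → (c ==ᶜ c) ≡ true
==ᶜ-refl white = refl
==ᶜ-refl black = refl

unblocked-child : ∀ c d ms ts → blocked c (node d ms ∷ ts) ≡ false → blocked d ms ≡ false
unblocked-child c d ms ts u = ∨-conicalˡ (blocked d ms) _ (∨-conicalˡ _ (blocked c ts) u)

unblocked-rest : ∀ c t ts → blocked c (t ∷ ts) ≡ false → blocked c ts ≡ false
unblocked-rest c t ts = ∨-conicalʳ (blocks c t) (blocked c ts)

unblocked-sameColourChild-unmixed : ∀ c ms ts → blocked c (node c ms ∷ ts) ≡ false → mixed c ms ≡ false
unblocked-sameColourChild-unmixed white ms ts u = ∨-conicalʳ (blocked white ms) _ (∨-conicalˡ _ (blocked white ts) u)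
unblocked-sameColourChild-unmixed black ms ts u = ∨-conicalʳ (blocked black ms) _ (∨-conicalˡ _ (blocked black ts) u)

mixed-antitone : ∀ {m d ks ks′} → ForestMove m ks ks′ → mixed d ks′ ≡ true → mixed d ks ≡ true
mixed-antitone {d = d} (inFirst {node e _} removeLeaf) = ∨-introʳ (not (d ==ᶜ e))
mixed-antitone (inFirst (inside _)) = id
mixed-antitone {d = d} (inRest {node e _} mv) = ∨-mono {not (d ==ᶜ e)} id (mixed-antitone mv)

mixed-preserved : ∀ {m ks ks′} → ForestMove m ks ks′ → mixed m ks ≡ true → mixed m ks′ ≡ true
mixed-preserved {m} (inFirst removeLeaf) rewrite ==ᶜ-refl m = id
mixed-preserved (inFirst (inside _)) = id
mixed-preserved {m} (inRest {node e _} mv) = ∨-mono {not (m ==ᶜ e)} id (mixed-preserved mv)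

blocked-antitone : ∀ {m c ks ks′} → ForestMove m ks ks′ → blocked c ks′ ≡ true → blocked c ks ≡ true
blocked-antitone {c = c} (inFirst {t} removeLeaf) = ∨-introʳ (blocks c t)
blocked-antitone {c = c} (inFirst (inside {d} mv)) =
  ∨-mono (∨-mono (blocked-antitone mv) (∧-monoʳ (c ==ᶜ d) (mixed-antitone mv))) id
blocked-antitone {c = c} (inRest {t} mv) = ∨-mono {blocks c t} id (blocked-antitone mv)

unblocked-after-move : ∀ {m c ks ks′} → ForestMove m ks ks′ → blocked c ks ≡ false → blocked c ks′ ≡ false
unblocked-after-move mv = contraposeᵇ (blocked-antitone mv)

valueT-unblocked : ∀ {d ks} → blocked d ks ≡ false → valueT (node d ks) ≡ valueF ks + sign d
valueT-unblocked b rewrite b = refl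

valueT-blocked : ∀ {d ks} → blocked d ks ≡ true → valueT (node d ks) ≡ valueF ks
valueT-blocked {ks = ks} b rewrite b = +-identityʳ (valueF ks)

mutual
  whiteMove-lowers : ∀ {ks ks′} → ForestMove white ks ks′ → valueF ks′ < valueF ks
  whiteMove-lowers (inFirst removeLeaf) = suc[i]≤j⇒i<j ≤-refl
  whiteMove-lowers (inFirst {ts = ts} (inside {d} mv)) = +-monoˡ-< (valueF ts) (insideWhiteMove-lowers d mv)
  whiteMove-lowers (inRest {t} mv) = +-monoʳ-< (valueT t) (whiteMove-lowers mv)

  insideWhiteMove-lowers : ∀ d {ks ks′} → ForestMove white ks ks′ → valueT (node d ks′) < valueT (node d ks)
  insideWhiteMove-lowers d {ks} {ks′} mv with blocked d ks in b | blocked d ks′ in b′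
  ... | true  | true  = +-monoˡ-< 0ℤ (whiteMove-lowers mv)
  ... | false | false = +-monoˡ-< (sign d) (whiteMove-lowers mv)
  ... | false | true  = ⊥-elim (true≢false (trans (sym b′) (unblocked-after-move mv b)))
  insideWhiteMove-lowers black mv | true | false = +-mono-<-≤ (whiteMove-lowers mv) -≤+
  insideWhiteMove-lowers white {ks} {ks′} mv | true | false = begin-strict
    valueF ks′ + 1ℤ  ≡⟨ +-comm (valueF ks′) 1ℤ ⟩
    sucℤ (valueF ks′) <⟨ proj₁ (whiteMove-unblocks mv b b′) ⟩
    valueF ks        ≡⟨ +-identityʳ (valueF ks) ⟨
    valueF ks + 0ℤ   ∎
    where open ≤-Reasoning

  -- A White move that unblocks a white node turns a blocked black child into an essential one.
  whiteMove-unblocks : ∀ {ks ks′} → ForestMove white ks ks′ → blocked white ks ≡ true → blocked white ks′ ≡ false →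
                       sucℤ (valueF ks′) < valueF ks × mixed white ks′ ≡ true
  whiteMove-unblocks (inFirst removeLeaf) b b′ = ⊥-elim (true≢false (trans (sym b) b′))
  whiteMove-unblocks (inFirst {ts = ts} (inside {white} {ks} {ks′} mv)) b b′ =
    ⊥-elim (true≢false (trans (sym ks′-mixed) (∨-conicalʳ (blocked white ks′) _ node′-clear)))
    where
    node′-clear : blocked white ks′ ∨ mixed white ks′ ≡ false
    node′-clear = ∨-conicalˡ _ (blocked white ts) b′

    ks′-mixed : mixed white ks′ ≡ true
    ks′-mixed = [ (λ ks-blocked → proj₂ (whiteMove-unblocks mv ks-blocked (∨-conicalˡ _ _ node′-clear)))
                , mixed-preserved mv
                ]′ (∨-true⁻ (blocked white ks) (∨-elimʳ b (unblocked-rest white (node white ks′) ts b′)))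
  whiteMove-unblocks (inFirst {ts = ts} (inside {black} {ks} {ks′} mv)) b b′ = lowers , refl
    where
    ks-blocked : blocked black ks ≡ true
    ks-blocked = ∨-elimʳ (∨-elimʳ b (unblocked-rest white (node black ks′) ts b′)) refl

    ks′-clear : blocked black ks′ ≡ false
    ks′-clear = unblocked-child white black ks′ ts b′

    lowers : sucℤ (valueT (node black ks′) + valueF ts) < valueT (node black ks) + valueF ts
    lowers = begin-strict
      1ℤ + (valueT (node black ks′) + valueF ts)
        ≡⟨ cong (λ v → 1ℤ + (v + valueF ts)) (valueT-unblocked {black} {ks′} ks′-clear) ⟩
      1ℤ + ((valueF ks′ + -1ℤ) + valueF ts)    ≡⟨ cancel (valueF ks′) (valueF ts) ⟩
      valueF ks′ + valueF ts                    <⟨ +-monoˡ-< (valueF ts) (whiteMove-lowers mv) ⟩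
      valueF ks + valueF ts                     ≡⟨ cong (_+ valueF ts) (valueT-blocked {black} {ks} ks-blocked) ⟨
      valueT (node black ks) + valueF ts        ∎
      where
      open ≤-Reasoning
      cancel : ∀ x y → 1ℤ + ((x + -1ℤ) + y) ≡ x + y
      cancel = solve-∀
  whiteMove-unblocks (inRest {t@(node e _)} {ts} {ts′} mv) b b′ =
    (begin-strict
      sucℤ (valueT t + valueF ts′) ≡⟨ +-sucℤ (valueT t) (valueF ts′) ⟨
      valueT t + sucℤ (valueF ts′) <⟨ +-monoʳ-< (valueT t) (proj₁ ih) ⟩
      valueT t + valueF ts         ∎) ,
    ∨-introʳ (not (white ==ᶜ e)) (proj₂ ih)
    where
    open ≤-Reasoning
    ih : sucℤ (valueF ts′) < valueF ts × mixed white ts′ ≡ true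
    ih = whiteMove-unblocks mv (∨-elimˡ b (∨-conicalˡ _ _ b′)) (unblocked-rest white t ts′ b′)

mutual
  unblocked-whiteMove-exact : ∀ c {ks ks′} → ForestMove white ks ks′ → blocked c ks ≡ false →
                              sucℤ (valueF ks′) ≡ valueF ks
  unblocked-whiteMove-exact c (inFirst removeLeaf) _ = refl
  unblocked-whiteMove-exact c (inFirst {ts = ts} (inside {d} {ks} {ks′} mv)) u =
    suc[i]≡j⇒suc[i+k]≡j+k (valueT (node d ks′)) (valueF ts)
      (unblocked-insideWhiteMove-exact mv (unblocked-child c d ks ts u))
  unblocked-whiteMove-exact c (inRest {t} {ts} {ts′} mv) u =
    suc[i]≡j⇒suc[k+i]≡k+j (valueF ts′) (valueT t) (unblocked-whiteMove-exact c mv (unblocked-rest c t ts u))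

  unblocked-insideWhiteMove-exact : ∀ {d ks ks′} → ForestMove white ks ks′ → blocked d ks ≡ false →
                                    sucℤ (valueT (node d ks′)) ≡ valueT (node d ks)
  unblocked-insideWhiteMove-exact {d} {ks} {ks′} mv u = begin
    1ℤ + valueT (node d ks′)    ≡⟨ cong (1ℤ +_) (valueT-unblocked {d} {ks′} (unblocked-after-move mv u)) ⟩
    1ℤ + (valueF ks′ + sign d)  ≡⟨ suc[i]≡j⇒suc[i+k]≡j+k (valueF ks′) (sign d) (unblocked-whiteMove-exact d mv u) ⟩
    valueF ks + sign d          ≡⟨ valueT-unblocked {d} {ks} u ⟨
    valueT (node d ks)          ∎
    where open ≡-Reasoning

mutual
  allWhite-whiteMove : ∀ ks → blocked white ks ≡ false → mixed white ks ≡ false → ∃[ r ] TreeMove white (node white ks) r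
  allWhite-whiteMove [] _ _ = [] , removeLeaf
  allWhite-whiteMove (node black ms ∷ ks) _ ()
  allWhite-whiteMove (node white ms ∷ ks) u _ = _ , inside (proj₂ (whiteChild-whiteMove ms ks u))

  whiteChild-whiteMove : ∀ ms ks → blocked white (node white ms ∷ ks) ≡ false →
                         ∃[ ks′ ] ForestMove white (node white ms ∷ ks) ks′
  whiteChild-whiteMove ms ks u =
    _ , inFirst (proj₂ (allWhite-whiteMove ms (unblocked-child white white ms ks u)
                                              (unblocked-sameColourChild-unmixed white ms ks u)))

mutual
  allBlack-valueT : ∀ ms → blocked black ms ≡ false → mixed black ms ≡ false → valueT (node black ms) ≤ -1ℤ
  allBlack-valueT ms u m = begin
    valueT (node black ms) ≡⟨ valueT-unblocked {black} {ms} u ⟩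
    valueF ms + -1ℤ        ≤⟨ +-monoˡ-≤ -1ℤ (allBlack-valueF ms u m) ⟩
    -1ℤ                    ∎
    where open ≤-Reasoning

  allBlack-valueF : ∀ ks → blocked black ks ≡ false → mixed black ks ≡ false → valueF ks ≤ 0ℤ
  allBlack-valueF [] _ _ = ≤-refl
  allBlack-valueF (node white ms ∷ ks) _ ()
  allBlack-valueF (node black ms ∷ ks) u m =
    +-mono-≤ (≤-trans (allBlack-valueT ms (unblocked-child black black ms ks u)
                                           (unblocked-sameColourChild-unmixed black ms ks u)) -≤+)
             (allBlack-valueF ks (unblocked-rest black (node black ms) ks u) m)

stuckBound : Color → ℤ
stuckBound white = 0ℤ
stuckBound black = -1ℤ

rootColor : Tree → Color
rootColor (node c _) = c

stuck-valueF : ∀ {ks} → All (λ k → valueT k ≤ stuckBound (rootColor k)) ks → valueF ks ≤ 0ℤ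
stuck-valueF [] = ≤-refl
stuck-valueF {node white _ ∷ _} (p ∷ ps) = +-mono-≤ p (stuck-valueF ps)
stuck-valueF {node black _ ∷ _} (p ∷ ps) = +-mono-≤ (≤-trans p -≤+) (stuck-valueF ps)

mutual
  whiteMove-or-stuckT : ∀ c ks → blocked c ks ≡ false →
                        (∃[ r ] TreeMove white (node c ks) r) ⊎ valueT (node c ks) ≤ stuckBound c
  whiteMove-or-stuckT white [] _ = inj₁ ([] , removeLeaf)
  whiteMove-or-stuckT white (node white ms ∷ ks) u = inj₁ (_ , inside (proj₂ (whiteChild-whiteMove ms ks u)))
  whiteMove-or-stuckT white (node black ms ∷ ks) u with whiteMove-or-stuckF white (node black ms ∷ ks) u
  ... | inj₁ (_ , mv) = inj₁ (_ , inside mv)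
  ... | inj₂ (p ∷ ps) = inj₂ (begin
    valueT (node white (node black ms ∷ ks))  ≡⟨ valueT-unblocked {white} {node black ms ∷ ks} u ⟩
    (valueT (node black ms) + valueF ks) + 1ℤ ≤⟨ +-monoˡ-≤ 1ℤ (+-mono-≤ p (stuck-valueF ps)) ⟩
    0ℤ                                        ∎)
    where open ≤-Reasoning
  whiteMove-or-stuckT black ks u with whiteMove-or-stuckF black ks u
  ... | inj₁ (_ , mv) = inj₁ (_ , inside mv)
  ... | inj₂ ps = inj₂ (begin
    valueT (node black ks) ≡⟨ valueT-unblocked {black} {ks} u ⟩
    valueF ks + -1ℤ        ≤⟨ +-monoˡ-≤ -1ℤ (stuck-valueF ps) ⟩
    -1ℤ                    ∎)
    where open ≤-Reasoning

  whiteMove-or-stuckF : ∀ c ks → blocked c ks ≡ false →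
                        (∃[ ks′ ] ForestMove white ks ks′) ⊎ All (λ k → valueT k ≤ stuckBound (rootColor k)) ks
  whiteMove-or-stuckF c [] _ = inj₂ []
  whiteMove-or-stuckF c (node d ms ∷ ks) u with whiteMove-or-stuckT d ms (unblocked-child c d ms ks u)
  ... | inj₁ (_ , mv) = inj₁ (_ , inFirst mv)
  ... | inj₂ bound with whiteMove-or-stuckF c ks (unblocked-rest c (node d ms) ks u)
  ...   | inj₁ (_ , mv) = inj₁ (_ , inRest mv)
  ...   | inj₂ bounds = inj₂ (bound ∷ bounds)

-- Needed below an unblocked black node: keeping a white child keeps the node mixed, so the
-- blocked status of its parent does not change.
whiteMove-leavingWhiteChild-first : ∀ d ms ks → blocked black (node d ms ∷ ks) ≡ false →
  1ℤ < valueF (node d ms ∷ ks) → 0ℤ < valueT (node d ms) →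
  ∃[ ks′ ] ForestMove white (node d ms ∷ ks) ks′ × mixed black ks′ ≡ true
whiteMove-leavingWhiteChild-first black ms ks u _ 0<t =
  ⊥-elim (<⇒≱ 0<t (≤-trans (allBlack-valueT ms (unblocked-child black black ms ks u)
                                                (unblocked-sameColourChild-unmixed black ms ks u)) -≤+))
whiteMove-leavingWhiteChild-first white [] ks u 1<v _ with mixed black ks in mx
... | true  = ks , inFirst removeLeaf , mx
... | false = ⊥-elim (<⇒≱ 1<v (+-monoʳ-≤ 1ℤ (allBlack-valueF ks (unblocked-rest black (node white []) ks u) mx)))
whiteMove-leavingWhiteChild-first white ms@(_ ∷ _) ks u _ 0<t
  with whiteMove-or-stuckT white ms (unblocked-child black white ms ks u)
... | inj₁ (_ , inside mv) = _ , inFirst (inside mv) , refl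
... | inj₂ bound = ⊥-elim (<⇒≱ 0<t bound)

whiteMove-leavingWhiteChild : ∀ ks → blocked black ks ≡ false → 1ℤ < valueF ks →
                              ∃[ ks′ ] ForestMove white ks ks′ × mixed black ks′ ≡ true
whiteMove-leavingWhiteChild [] _ (+<+ ())
whiteMove-leavingWhiteChild (node d ms ∷ ks) u 1<v with <-+⇒ (valueT (node d ms)) (valueF ks) 1<v
... | inj₁ 0<t = whiteMove-leavingWhiteChild-first d ms ks u 1<v 0<t
... | inj₂ 1<rest =
  let (ks′ , mv , mx) = whiteMove-leavingWhiteChild ks (unblocked-rest black (node d ms) ks u) 1<rest
  in _ , inRest mv , ∨-introʳ (not (black ==ᶜ d)) mx

valueF-++ : ∀ ks ks′ → valueF (ks ++ ks′) ≡ valueF ks + valueF ks′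
valueF-++ []       ks′ = sym (+-identityˡ (valueF ks′))
valueF-++ (t ∷ ks) ks′ = trans (cong (valueT t +_) (valueF-++ ks ks′)) (sym (+-assoc (valueT t) (valueF ks) (valueF ks′)))

blocked-++ : ∀ c ks ks′ → blocked c (ks ++ ks′) ≡ blocked c ks ∨ blocked c ks′
blocked-++ c []       ks′ = refl
blocked-++ c (t ∷ ks) ks′ = trans (cong (blocks c t ∨_) (blocked-++ c ks ks′)) (sym (∨-assoc (blocks c t) _ _))

blocks-cong : ∀ c {d ks ks′} → blocked d ks′ ≡ blocked d ks → (blocked d ks ≡ false → mixed d ks′ ≡ mixed d ks) →
              blocks c (node d ks′) ≡ blocks c (node d ks)
blocks-cong c {d} {ks} eb em with blocked d ks in b
... | true  rewrite eb = refl
... | false rewrite eb | em refl = refl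

-- Since a safe move changes the blocked status of no enclosing node, it can be found subtree by subtree.
SafeTreeMove : Tree → Forest → Set
SafeTreeMove t r = TreeMove white t r × sucℤ (valueF r) ≡ valueT t × (∀ c → blocked c r ≡ blocks c t)

SafeMove : Forest → Forest → Set
SafeMove ks ks′ = ForestMove white ks ks′ × sucℤ (valueF ks′) ≡ valueF ks × (∀ c → blocked c ks′ ≡ blocked c ks)

safeMove-first : ∀ {t r ts} → SafeTreeMove t r → SafeMove (t ∷ ts) (r ++ ts)
safeMove-first {t} {r} {ts} (mv , desc , keeps) =
  inFirst mv ,
  trans (cong sucℤ (valueF-++ r ts)) (suc[i]≡j⇒suc[i+k]≡j+k (valueF r) (valueF ts) desc) ,
  λ c → trans (blocked-++ c r ts) (cong (_∨ blocked c ts) (keeps c))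

safeMove-rest : ∀ {t ks ks′} → SafeMove ks ks′ → SafeMove (t ∷ ks) (t ∷ ks′)
safeMove-rest {t} {ks′ = ks′} (mv , desc , keeps) =
  inRest mv , suc[i]≡j⇒suc[k+i]≡k+j (valueF ks′) (valueT t) desc , λ c → cong (blocks c t ∨_) (keeps c)

safeTreeMove-inside : ∀ {d ks ks′} → ForestMove white ks ks′ → sucℤ (valueT (node d ks′)) ≡ valueT (node d ks) →
                      blocked d ks′ ≡ blocked d ks → (blocked d ks ≡ false → mixed d ks′ ≡ mixed d ks) →
                      SafeTreeMove (node d ks) (node d ks′ ∷ [])
safeTreeMove-inside {d} {ks} {ks′} mv desc eb em =
  inside mv ,
  trans (cong sucℤ (+-identityʳ (valueT (node d ks′)))) desc ,
  λ c → trans (∨-identityʳ _) (blocks-cong c {d} {ks} {ks′} eb em)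

blocked-safeTreeMove : ∀ {d ks ks′} → blocked d ks ≡ true → SafeMove ks ks′ → SafeTreeMove (node d ks) (node d ks′ ∷ [])
blocked-safeTreeMove {d} {ks} {ks′} b (mv , desc , keeps) =
  safeTreeMove-inside mv desc′ (keeps d) (λ u → ⊥-elim (true≢false (trans (sym b) u)))
  where
  desc′ : sucℤ (valueT (node d ks′)) ≡ valueT (node d ks)
  desc′ = begin
    1ℤ + valueT (node d ks′) ≡⟨ cong (1ℤ +_) (valueT-blocked {d} {ks′} (trans (keeps d) b)) ⟩
    1ℤ + valueF ks′          ≡⟨ desc ⟩
    valueF ks                ≡⟨ valueT-blocked {d} {ks} b ⟨
    valueT (node d ks)       ∎
    where open ≡-Reasoning

unblocked-safeTreeMove : ∀ {d ks} → blocked d ks ≡ false → 0ℤ < valueT (node d ks) → ∃[ r ] SafeTreeMove (node d ks) r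
unblocked-safeTreeMove {white} {[]} _ _ = [] , removeLeaf , refl , λ c → sym (∧-zeroʳ (c ==ᶜ white))
unblocked-safeTreeMove {black} {[]} _ ()
unblocked-safeTreeMove {white} {ks@(_ ∷ _)} u 0<v with whiteMove-or-stuckT white ks u
... | inj₁ (_ , inside mv) =
  _ , safeTreeMove-inside mv (unblocked-insideWhiteMove-exact mv u) (trans (unblocked-after-move mv u) (sym u))
                          (λ _ → ⇔ᵇ⇒≡ (mixed-antitone mv) (mixed-preserved mv))
... | inj₂ bound = ⊥-elim (<⇒≱ 0<v bound)
unblocked-safeTreeMove {black} {ks@(_ ∷ _)} u 0<v =
  let (ks′ , mv , mx) = whiteMove-leavingWhiteChild ks u 1<ks
  in _ , safeTreeMove-inside mv (unblocked-insideWhiteMove-exact mv u) (trans (unblocked-after-move mv u) (sym u))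
                             (λ _ → trans mx (sym (mixed-antitone mv mx)))
  where
  1<ks : 1ℤ < valueF ks
  1<ks = begin-strict
    1ℤ                       <⟨ +-monoˡ-< 1ℤ (subst (0ℤ <_) (valueT-unblocked {black} {ks} u) 0<v) ⟩
    (valueF ks + -1ℤ) + 1ℤ   ≡⟨ +-assoc (valueF ks) -1ℤ 1ℤ ⟩
    valueF ks + 0ℤ           ≡⟨ +-identityʳ (valueF ks) ⟩
    valueF ks                ∎
    where open ≤-Reasoning

mutual
  safeTreeMove : ∀ c ks → 0ℤ < valueT (node c ks) → ∃[ r ] SafeTreeMove (node c ks) r
  safeTreeMove c ks 0<v = [ byBlocked , (λ u → unblocked-safeTreeMove u 0<v) ]′ (true-or-false (blocked c ks))
    where
    byBlocked : blocked c ks ≡ true → ∃[ r ] SafeTreeMove (node c ks) r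
    byBlocked b = let (_ , safe) = safeMove ks (subst (0ℤ <_) (valueT-blocked {c} {ks} b) 0<v)
                  in _ , blocked-safeTreeMove b safe

  safeMove : ∀ ks → 0ℤ < valueF ks → ∃[ ks′ ] SafeMove ks ks′
  safeMove [] (+<+ ())
  safeMove (node c ms ∷ ks) 0<v with <-+⇒ (valueT (node c ms)) (valueF ks) 0<v
  ... | inj₁ 0<t    = let (_ , safe) = safeTreeMove c ms 0<t in _ , safeMove-first safe
  ... | inj₂ 0<rest = let (_ , safe) = safeMove ks 0<rest in _ , safeMove-rest safe

invert-==ᶜ : ∀ c d → (invert c ==ᶜ invert d) ≡ (c ==ᶜ d)
invert-==ᶜ white white = refl
invert-==ᶜ white black = refl
invert-==ᶜ black white = refl
invert-==ᶜ black black = refl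

mixed-invert : ∀ d ms → mixed (invert d) (invertF ms) ≡ mixed d ms
mixed-invert d []              = refl
mixed-invert d (node e _ ∷ ms) = cong₂ (λ x y → not x ∨ y) (invert-==ᶜ d e) (mixed-invert d ms)

blocked-invert : ∀ c ks → blocked (invert c) (invertF ks) ≡ blocked c ks
blocked-invert c []              = refl
blocked-invert c (node d ms ∷ ts) =
  cong₂ _∨_ (cong₂ _∨_ (blocked-invert d ms) (cong₂ _∧_ (invert-==ᶜ c d) (mixed-invert d ms))) (blocked-invert c ts)

sign-invert : ∀ c → sign (invert c) ≡ - sign c
sign-invert white = refl
sign-invert black = refl

mutual
  valueT-invert : ∀ t → valueT (invertT t) ≡ - valueT t
  valueT-invert (node c ks) rewrite blocked-invert c ks with blocked c ks
  ... | true  = trans (cong (_+ 0ℤ) (valueF-invert ks)) (sym (neg-distrib-+ (valueF ks) 0ℤ))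
  ... | false = trans (cong₂ _+_ (valueF-invert ks) (sign-invert c)) (sym (neg-distrib-+ (valueF ks) (sign c)))

  valueF-invert : ∀ f → valueF (invertF f) ≡ - valueF f
  valueF-invert []       = refl
  valueF-invert (t ∷ ts) =
    trans (cong₂ _+_ (valueT-invert t) (valueF-invert ts)) (sym (neg-distrib-+ (valueT t) (valueF ts)))

blackMove-raises : ∀ {f f′} → ForestMove black f f′ → valueF f < valueF f′
blackMove-raises {f} {f′} mv =
  neg-cancel-< (subst₂ _<_ (valueF-invert f′) (valueF-invert f) (whiteMove-lowers (invert-forestMove mv)))

blackMove-ascends : ∀ f → valueF f < 0ℤ → ∃[ f′ ] ForestMove black f f′ × valueF f′ ≡ sucℤ (valueF f)
blackMove-ascends f f<0 =
  let (g , mv , desc , _) = safeMove (invertF f) (subst (0ℤ <_) (sym (valueF-invert f)) (neg-mono-< f<0))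
  in invertF g , subst (λ h → ForestMove black h (invertF g)) (invertF-involutive f) (invert-forestMove mv) ,
     value g desc
  where
  value : ∀ g → sucℤ (valueF g) ≡ valueF (invertF f) → valueF (invertF g) ≡ sucℤ (valueF f)
  value g desc = begin
    valueF (invertF g)        ≡⟨ valueF-invert g ⟩
    - valueF g                ≡⟨ cong -_ (pred-suc (valueF g)) ⟨
    - pred (sucℤ (valueF g))  ≡⟨ cong (-_ ∘ pred) (trans desc (valueF-invert f)) ⟩
    - pred (- valueF f)       ≡⟨ neg-distrib-pred (- valueF f) ⟩
    sucℤ (- - valueF f)       ≡⟨ cong sucℤ (neg-involutive (valueF f)) ⟩
    sucℤ (valueF f)           ∎
    where open ≡-Reasoning

whiteMove-descends : ∀ f → 0ℤ < valueF f → ∃[ f′ ] ForestMove white f f′ × valueF f′ ≡ pred (valueF f)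
whiteMove-descends f 0<v =
  let (f′ , mv , desc , _) = safeMove f 0<v
  in f′ , mv , trans (sym (pred-suc (valueF f′))) (cong pred desc)

poN-value : ∀ n f → sizeF f ≡ n → HasValue (PoN n f) (valueF f)
poN-value zero [] _ = hasValue (λ ()) (λ ()) (λ { (+<+ ()) }) (λ { (+<+ ()) })
poN-value zero (node _ _ ∷ _) ()
poN-value (suc n) f size =
  hasValue (option white (_< valueF f) whiteMove-lowers) (option black (valueF f <_) blackMove-raises) bestL bestR
  where
  afterMove : ∀ {m f′} → ForestMove m f f′ → HasValue (PoN n f′) (valueF f′)
  afterMove {f′ = f′} mv = poN-value n f′ (ℕ.suc-injective (trans (sym (forestMove-size mv)) size))

  option : ∀ m (R : ℤ → Set) → (∀ {f′} → ForestMove m f f′ → R (valueF f′)) →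
           ∀ {g} → g ∈ map (PoN n) (remF m f) → ∃[ v ] R v × HasValue g v
  option m R bound g∈ =
    let (f′ , f′∈ , g≡) = ∈-map⁻ (PoN n) g∈
        mv = ∈-remF⁻ m f f′∈
    in valueF f′ , bound mv , subst (λ h → HasValue h (valueF f′)) (sym g≡) (afterMove mv)

  bestL : 0ℤ < valueF f → ∃[ g ] g ∈ map (PoN n) (remF white f) × HasValue g (pred (valueF f))
  bestL 0<v = let (f′ , mv , v≡) = whiteMove-descends f 0<v
              in PoN n f′ , ∈-map⁺ (PoN n) (∈-remF⁺ mv) , subst (HasValue (PoN n f′)) v≡ (afterMove mv)

  bestR : valueF f < 0ℤ → ∃[ g ] g ∈ map (PoN n) (remF black f) × HasValue g (sucℤ (valueF f))
  bestR v<0 = let (f′ , mv , v≡) = blackMove-ascends f v<0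
              in PoN n f′ , ∈-map⁺ (PoN n) (∈-remF⁺ mv) , subst (HasValue (PoN n f′)) v≡ (afterMove mv)

po-value : ∀ f → HasValue (Po f) (valueF f)
po-value f = poN-value (sizeF f) f refl

mutual
  essentialT : (t : Tree) → UpT t
  essentialT (node c ks) = if blocked c ks then cut (essentialF ks) else whole

  essentialF : (f : Forest) → UpF f
  essentialF []       = []
  essentialF (t ∷ ts) = essentialT t ∷ essentialF ts

≢⇒not-==ᶜ : ∀ {d e} → d ≢ e → not (d ==ᶜ e) ≡ true
≢⇒not-==ᶜ {white} {white} ne = ⊥-elim (ne refl)
≢⇒not-==ᶜ {white} {black} _  = refl
≢⇒not-==ᶜ {black} {white} _  = refl
≢⇒not-==ᶜ {black} {black} ne = ⊥-elim (ne refl)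

not-==ᶜ⇒≢ : ∀ {d e} → not (d ==ᶜ e) ≡ true → d ≢ e
not-==ᶜ⇒≢ {white} {black} _ ()
not-==ᶜ⇒≢ {black} {white} _ ()

==ᶜ⇒≡ : ∀ {c d} → (c ==ᶜ d) ≡ true → c ≡ d
==ᶜ⇒≡ {white} {white} _ = refl
==ᶜ⇒≡ {black} {black} _ = refl

∈⇒mixed : ∀ {d e ns ms} → node e ns ∈ ms → d ≢ e → mixed d ms ≡ true
∈⇒mixed (here refl) ne = ∨-introˡ _ (≢⇒not-==ᶜ ne)
∈⇒mixed {d} {ms = node e _ ∷ _} (there m) ne = ∨-introʳ (not (d ==ᶜ e)) (∈⇒mixed m ne)

mixed⇒∈ : ∀ d ms → mixed d ms ≡ true → ∃[ e ] ∃[ ns ] node e ns ∈ ms × d ≢ e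
mixed⇒∈ d (node e ns ∷ ms) p with ∨-true⁻ (not (d ==ᶜ e)) p
... | inj₁ q = e , ns , here refl , not-==ᶜ⇒≢ q
... | inj₂ q = let (e′ , ns′ , m , ne) = mixed⇒∈ d ms q in e′ , ns′ , there m , ne

∈⇒blocked : ∀ {c t ks} → t ∈ ks → blocks c t ≡ true → blocked c ks ≡ true
∈⇒blocked (here refl) p = ∨-introˡ _ p
∈⇒blocked {c} {ks = t ∷ _} (there m) p = ∨-introʳ (blocks c t) (∈⇒blocked m p)

hasBlock⇒blocked : ∀ {c ks} → HasBlockT (node c ks) → blocked c ks ≡ true
hasBlock⇒blocked {c} (here {ms = ms} m₁ m₂ refl ne) =
  ∈⇒blocked m₁ (∨-introʳ (blocked c ms)
    (subst (λ b → b ∧ mixed c ms ≡ true) (sym (==ᶜ-refl c)) (∈⇒mixed m₂ ne)))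
hasBlock⇒blocked (there {t = node d ms} m h) = ∈⇒blocked m (∨-introˡ _ (hasBlock⇒blocked h))

hasBlock-∷ : ∀ {c t ts} → HasBlockT (node c ts) → HasBlockT (node c (t ∷ ts))
hasBlock-∷ (here m₁ m₂ eq ne) = here (there m₁) m₂ eq ne
hasBlock-∷ (there m h)        = there (there m) h

blocked⇒hasBlock : ∀ c ks → blocked c ks ≡ true → HasBlockT (node c ks)
blocked⇒hasBlock c (node d ms ∷ ts) p with ∨-true⁻ (blocks c (node d ms)) p
... | inj₂ q = hasBlock-∷ (blocked⇒hasBlock c ts q)
... | inj₁ q with ∨-true⁻ (blocked d ms) q
...   | inj₁ r = there (here refl) (blocked⇒hasBlock d ms r)
...   | inj₂ r = let (e , ns , m , ne) = mixed⇒∈ d ms (∧-conicalʳ _ _ r)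
                 in here (here refl) m (==ᶜ⇒≡ (∧-conicalˡ _ _ r)) ne

mutual
  essential-blockFreeT : ∀ c ks → ¬ HasBlockF (carT (essentialT (node c ks)))
  essential-blockFreeT c ks with blocked c ks in b
  ... | true  = essential-blockFreeF ks
  ... | false = λ { (here h) → true≢false (trans (sym (hasBlock⇒blocked h)) b) ; (there ()) }

  essential-blockFreeF : ∀ f → ¬ HasBlockF (carF (essentialF f))
  essential-blockFreeF (node c ks ∷ ts) h =
    [ essential-blockFreeT c ks , essential-blockFreeF ts ]′ (++⁻ (carT (essentialT (node c ks))) h)

mutual
  essential-maximalT : ∀ c ks (v : UpT (node c ks)) → ¬ HasBlockF (carT v) → v ⊆T essentialT (node c ks)
  essential-maximalT c ks whole noBlock with blocked c ks in b
  ... | true  = ⊥-elim (noBlock (here (blocked⇒hasBlock c ks b)))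
  ... | false = tt
  essential-maximalT c ks (cut w) noBlock with blocked c ks
  ... | true  = essential-maximalF ks w noBlock
  ... | false = tt

  essential-maximalF : ∀ f (V : UpF f) → ¬ HasBlockF (carF V) → V ⊆F essentialF f
  essential-maximalF [] [] _ = tt
  essential-maximalF (node c ks ∷ ts) (v ∷ vs) noBlock =
    essential-maximalT c ks v (noBlock ∘ ++⁺ˡ) , essential-maximalF ts vs (noBlock ∘ ++⁺ʳ (carT v))

mutual
  carT-antisym : ∀ {t} (u v : UpT t) → u ⊆T v → v ⊆T u → carT u ≡ carT v
  carT-antisym whole   whole   _ _ = refl
  carT-antisym (cut u) (cut v) p q = carF-antisym u v p q

  carF-antisym : ∀ {f} (U V : UpF f) → U ⊆F V → V ⊆F U → carF U ≡ carF V
  carF-antisym []       []       _        _        = refl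
  carF-antisym (u ∷ us) (v ∷ vs) (p , ps) (q , qs) = cong₂ _++_ (carT-antisym u v p q) (carF-antisym us vs ps qs)

mutual
  valueT-essential : ∀ c ks → valueT (node c ks) ≡ valueF (carT (essentialT (node c ks)))
  valueT-essential c ks with blocked c ks in b
  ... | true  = trans (+-identityʳ (valueF ks)) (valueF-essential ks)
  ... | false = sym (trans (+-identityʳ (valueT (node c ks))) (valueT-unblocked {c} {ks} b))

  valueF-essential : ∀ f → valueF f ≡ valueF (carF (essentialF f))
  valueF-essential []               = refl
  valueF-essential (node c ks ∷ ts) =
    trans (cong₂ _+_ (valueT-essential c ks) (valueF-essential ts))
          (sym (valueF-++ (carT (essentialT (node c ks))) (carF (essentialF ts))))

isEss-essential : ∀ P → IsEss P (essentialF (forestOf P))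
isEss-essential P = essential-blockFreeF (forestOf P) , λ V noBlock _ → essential-maximalF (forestOf P) V noBlock

isEss⇒carF≡essential : ∀ P U → IsEss P U → carF U ≡ carF (essentialF (forestOf P))
isEss⇒carF≡essential P U (noBlock , maximal) =
  carF-antisym U (essentialF f) U⊆ess (maximal _ (essential-blockFreeF f) U⊆ess)
  where
  f : Forest
  f = forestOf P

  U⊆ess : U ⊆F essentialF f
  U⊆ess = essential-maximalF f U noBlock

sameValue⇒Po≈G : ∀ f g → valueF f ≡ valueF g → Po f ≈G Po g
sameValue⇒Po≈G f g v≡ =
  zero-secondPlayerWin (subst (HasValue _) difference (sumValue (po-value f) (negValue (po-value g))))
  where
  difference : valueF f + - valueF g ≡ 0ℤ
  difference = trans (cong (λ v → valueF f + - v) (sym v≡)) (+-inverseʳ (valueF f))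

mainTheorem13 : (P : TreePoset) →
    Σ (UpF (forestOf P)) (λ U → IsEss P U) ×
    ((U : UpF (forestOf P)) → IsEss P U → Po (forestOf P) ≈G Po (carF U))
mainTheorem13 P = (essentialF f , isEss-essential P) , λ U isEss →
  sameValue⇒Po≈G f (carF U) (trans (valueF-essential f) (cong valueF (sym (isEss⇒carF≡essential P U isEss))))
  where
  f : Forest
  f = forestOf P
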